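{- Let $m\ge 3$ and $n\ge 2$. For every positive integer $k$, $$\chi_{B_m^n}(2k+1)=\Big[\sum_{i=0}^{m-2}(-1)^i(2k)^{(m-2)-i}\Big]\,\chi_{B_m^{n-1}}(2k+1).$$
   Context: A signed graph $(G,\sigma)$ is a finite graph $G$ (parallel edges and loops allowed) with a sign function $\sigma:E(G)\to\{+1,-1\}$. A signed coloring in $2k+1$ colors is a map $c:V(G)\to\{ -k,\dots,0,\dots,k\}$; it is proper if $c(y)\neq\sigma(e)c(x)$ for every edge $e=xy$ (including loops, where $x=y$). The signed chromatic polynomial $\chi_{(G,\sigma)}(2k+1)$ is the number of proper signed colorings in $2k+1$ colors. For integers $m\ge 3$, $n\ge 1$, the Book graph $B(m,n)$ has vertex set $\{u,v\}\cup\{u_j^l:1\le l\le n,\,1\le j\le m-2\}$ and consists of the $n$ cycles $u\,u_1^l\cdots u_{m-2}^l\,v\,u$ sharing the edge $uv$. The signed graph $B_m^n$ is obtained from $B(m,n)$ with all edges positive by replacing the edge $uv$ with two parallel edges between $u$ and $v$, one positive and one negative. -}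

module Defs where

open import Data.Nat as ℕ using (ℕ; zero; suc; _∸_)
open import Data.Integer as ℤ using (ℤ; +_; -_; _-_)
open import Data.Fin using (Fin; zero; suc; combine; inject₁; fromℕ)
open import Data.Vec as Vec using (Vec; []; _∷_; lookup)
open import Data.List as List using (List; []; _∷_; map; upTo; allFin; concatMap; length; filter; foldr)
open import Data.List.Relation.Unary.All as All using (All; all?)
open import Data.Product using (_×_; _,_)
open import Relation.Binary.PropositionalEquality using (_≡_)
open import Relation.Nullary using (¬_; Dec; ¬?)

data Sgn : Set where
  pos neg : Sgn

act : Sgn → ℤ → ℤ
act pos x = x
act neg x = - x

-- A (finite) signed graph on vertex set Fin nV, given as a list of edges
-- (x , y , σ); parallel edges and loops are allowed.
record SignedGraph : Set where
  constructor mkSG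
  field
    nV    : ℕ
    edges : List (Fin nV × Fin nV × Sgn)
open SignedGraph public

-- the 2k+1 signed colours  -k , … , 0 , … , k
colours : ℕ → List ℤ
colours k = map (λ i → + i - + k) (upTo (suc (2 ℕ.* k)))

colourings : (k N : ℕ) → List (Vec ℤ N)
colourings k zero    = [] ∷ []
colourings k (suc N) =
  concatMap (λ a → map (a ∷_) (colourings k N)) (colours k)

Proper : (G : SignedGraph) → Vec ℤ (nV G) → Set
Proper G c = All (λ { (x , y , s) → ¬ (lookup c y ≡ act s (lookup c x)) }) (edges G)

proper? : (G : SignedGraph) → (c : Vec ℤ (nV G)) → Dec (Proper G c)
proper? G c = all? (λ { (x , y , s) → ¬? (lookup c y ℤ.≟ act s (lookup c x)) }) (edges G)

-- signed chromatic polynomial evaluated at 2k+1: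
-- the number of proper signed colourings in 2k+1 colours
χ : SignedGraph → (k : ℕ) → ℕ
χ G k = length (filter (proper? G) (colourings k (nV G)))

-- Book signed graph B_m^n with q = m - 2 internal vertices per page.
-- Vertex 0 = u, vertex 1 = v, vertex 2 + combine l j = u_{j+1}^{l+1}.
module _ (n q : ℕ) where
  BV : Set
  BV = Fin (2 ℕ.+ n ℕ.* q)

  bu bv : BV
  bu = zero
  bv = suc zero

  bw : Fin n → Fin q → BV
  bw l j = suc (suc (combine l j))

pageEdges : (n q : ℕ) → Fin n → List (BV n q × BV n q × Sgn)
pageEdges n zero    l = (bu n zero , bv n zero , pos) ∷ []   -- degenerate (m = 2), unused
pageEdges n (suc p) l =
  (bu n (suc p) , bw n (suc p) l zero , pos)
  ∷ (bw n (suc p) l (fromℕ p) , bv n (suc p) , pos)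
  ∷ map (λ j → (bw n (suc p) l (inject₁ j) , bw n (suc p) l (suc j) , pos)) (allFin p)

-- B_m^n : the n cycles u u_1^l … u_{m-2}^l v u sharing uv, all edges positive,
-- with uv replaced by a positive and a negative parallel edge.
Book : (m n : ℕ) → SignedGraph
Book m n = mkSG (2 ℕ.+ n ℕ.* (m ∸ 2))
  ((bu n (m ∸ 2) , bv n (m ∸ 2) , pos)
   ∷ (bu n (m ∸ 2) , bv n (m ∸ 2) , neg)
   ∷ concatMap (pageEdges n (m ∸ 2)) (allFin n))

bookFactor : (m k : ℕ) → ℤ
bookFactor m k =
  foldr ℤ._+_ (+ 0)
    (map (λ i → (ℤ.-1ℤ ℤ.^ i) ℤ.* ((+ (2 ℕ.* k)) ℤ.^ ((m ∸ 2) ∸ i))) (upTo (suc (m ∸ 2))))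

module Submission where

-- Write T(q) = Σ_{i=0}^{q} (-1)^i (2k)^{q-i}, so that the factor in the statement
-- is T(m-2), and put q = m - 2 ≥ 1.  Counting is done in ℤ: χ is a sum of 0/1
-- indicators over the list of all colourings, and the properness indicator of a
-- signed graph is the product of the indicators of its edges.
--
--  (1) Paths.  For colours a, b, the number of colour vectors w of length q with
--      a, w₁, …, w_q, b consecutively distinct is T(q) - [a = b]·(-1)^q.  Peeling
--      off w₁ gives P(q+1,a,b) = Σ_x [x ≠ a]·P(q,x,b), and T satisfies
--      T(q+1) = 2k·T(q) + (-1)^(q+1); each colour occurs once in the colour set.
--  (2) Books.  Colour u, v, the first page and the remaining pages separately:
--      the properness indicator of B_m^(n+1) is that of B_m^n times the path
--      indicator of the first page.
--  (3) The positive spine edge forces c(u) ≠ c(v), so summing over the colours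
--      of the first page contributes exactly the factor T(q).  The recursion holds for every n ≥ 1 and every k; the
-- theorem is its case n ≥ 2.

open import Defs
open import Data.Nat using (ℕ; _≤_; pred)
open import Data.Integer using (+_; _*_)
open import Relation.Binary.PropositionalEquality using (_≡_)

open import Data.Nat as ℕ using (zero; suc; s≤s; _∸_)
import Data.Nat.Properties as ℕP
open import Data.Integer as ℤ using (ℤ; _+_; -_; _-_; 0ℤ; 1ℤ; -1ℤ; _^_)
import Data.Integer.Properties as ℤP
open import Data.Integer.Tactic.RingSolver using (solve-∀)
open import Data.Bool using (Bool; true; false; _∧_)
open import Data.Fin using (Fin; zero; suc; inject₁; fromℕ; combine)
open import Data.Vec using (Vec; []; _∷_; lookup; tabulate) renaming (_++_ to _++ᵥ_)
import Data.Vec.Properties as VecP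
open import Data.List as List using (List; []; _∷_; map; upTo; allFin; concatMap; length; filter; foldr; _++_; _∷ʳ_)
import Data.List.Properties as LP
open import Data.List.Relation.Unary.All as All using (all?)
open import Data.List.Relation.Unary.AllPairs using ([]; _∷_)
open import Data.List.Relation.Unary.Any using (here; there)
open import Data.List.Membership.Propositional using (_∈_; _∉_)
open import Data.List.Membership.Propositional.Properties using (∈-upTo⁻)
open import Data.List.Relation.Unary.Unique.Propositional using (Unique)
import Data.List.Relation.Unary.Unique.Propositional.Properties as UniqueP
open import Data.Product using (_×_; _,_)
open import Relation.Binary.PropositionalEquality using (refl; sym; trans; cong; cong₂; module ≡-Reasoning)
open import Relation.Nullary using (Dec; yes; no; does; ¬?)
open import Data.Empty using (⊥-elim)
open import Function using (_∘_; id)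

∑ : ∀ {a} {A : Set a} → List A → (A → ℤ) → ℤ
∑ []       f = 0ℤ
∑ (x ∷ xs) f = f x + ∑ xs f

∏ : ∀ {a} {A : Set a} → List A → (A → ℤ) → ℤ
∏ []       f = 1ℤ
∏ (x ∷ xs) f = f x * ∏ xs f

syntax ∑ xs (λ x → e) = ∑[ x ∈ xs ] e
syntax ∏ xs (λ x → e) = ∏[ x ∈ xs ] e

module _ {a} {A : Set a} where

  ∑-++ : (xs ys : List A) (f : A → ℤ) → ∑ (xs ++ ys) f ≡ ∑ xs f + ∑ ys f
  ∑-++ []       ys f = sym (ℤP.+-identityˡ _)
  ∑-++ (x ∷ xs) ys f = trans (cong (λ z → f x + z) (∑-++ xs ys f)) (sym (ℤP.+-assoc (f x) _ _))

  ∑-cong : (xs : List A) {f g : A → ℤ} → (∀ {x} → x ∈ xs → f x ≡ g x) → ∑ xs f ≡ ∑ xs g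
  ∑-cong []       h = refl
  ∑-cong (x ∷ xs) h = cong₂ _+_ (h (here refl)) (∑-cong xs (h ∘ there))

  ∑-ext : (xs : List A) {f g : A → ℤ} → (∀ x → f x ≡ g x) → ∑ xs f ≡ ∑ xs g
  ∑-ext xs h = ∑-cong xs (λ {x} _ → h x)

  ∏-ext : (xs : List A) {f g : A → ℤ} → (∀ x → f x ≡ g x) → ∏ xs f ≡ ∏ xs g
  ∏-ext []       h = refl
  ∏-ext (x ∷ xs) h = cong₂ _*_ (h x) (∏-ext xs h)

  ∑-zero : (xs : List A) → ∑[ x ∈ xs ] 0ℤ ≡ 0ℤ
  ∑-zero []       = refl
  ∑-zero (x ∷ xs) = trans (ℤP.+-identityˡ _) (∑-zero xs)

  ∑-+ : (xs : List A) (f g : A → ℤ) → ∑[ x ∈ xs ] (f x + g x) ≡ ∑ xs f + ∑ xs g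
  ∑-+ []       f g = refl
  ∑-+ (x ∷ xs) f g = trans (cong (λ z → f x + g x + z) (∑-+ xs f g)) (interchange (f x) (g x) _ _)
    where
    interchange : ∀ a b c d → a + b + (c + d) ≡ a + c + (b + d)
    interchange = solve-∀

  ∑-*ˡ : (xs : List A) (c : ℤ) (f : A → ℤ) → ∑[ x ∈ xs ] (c * f x) ≡ c * ∑ xs f
  ∑-*ˡ []       c f = sym (ℤP.*-zeroʳ c)
  ∑-*ˡ (x ∷ xs) c f = trans (cong (λ z → c * f x + z) (∑-*ˡ xs c f)) (sym (ℤP.*-distribˡ-+ c (f x) _))

  ∑-const : (xs : List A) (t : ℤ) → ∑[ x ∈ xs ] t ≡ + length xs * t
  ∑-const []       t = sym (ℤP.*-zeroˡ t)
  ∑-const (x ∷ xs) t = trans (cong (λ z → t + z) (∑-const xs t)) (step (+ length xs) t)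
    where
    step : ∀ n t → t + n * t ≡ (1ℤ + n) * t
    step = solve-∀

  ∏-++ : (xs ys : List A) (f : A → ℤ) → ∏ (xs ++ ys) f ≡ ∏ xs f * ∏ ys f
  ∏-++ []       ys f = sym (ℤP.*-identityˡ _)
  ∏-++ (x ∷ xs) ys f = trans (cong (f x *_) (∏-++ xs ys f)) (sym (ℤP.*-assoc (f x) _ _))

  foldr-sum : (g : A → ℤ) (xs : List A) → foldr _+_ 0ℤ (map g xs) ≡ ∑ xs g
  foldr-sum g []       = refl
  foldr-sum g (x ∷ xs) = cong (λ z → g x + z) (foldr-sum g xs)

module _ {a b} {A : Set a} {B : Set b} where

  ∑-map : (g : A → B) (xs : List A) (f : B → ℤ) → ∑ (map g xs) f ≡ ∑ xs (f ∘ g)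
  ∑-map g []       f = refl
  ∑-map g (x ∷ xs) f = cong (λ z → f (g x) + z) (∑-map g xs f)

  ∏-map : (g : A → B) (xs : List A) (f : B → ℤ) → ∏ (map g xs) f ≡ ∏ xs (f ∘ g)
  ∏-map g []       f = refl
  ∏-map g (x ∷ xs) f = cong (f (g x) *_) (∏-map g xs f)

  ∑-concatMap : (g : A → List B) (xs : List A) (f : B → ℤ) →
    ∑ (concatMap g xs) f ≡ ∑[ x ∈ xs ] ∑ (g x) f
  ∑-concatMap g []       f = refl
  ∑-concatMap g (x ∷ xs) f =
    trans (∑-++ (g x) (concatMap g xs) f) (cong (λ z → ∑ (g x) f + z) (∑-concatMap g xs f))

  ∏-concatMap : (g : A → List B) (xs : List A) (f : B → ℤ) →
    ∏ (concatMap g xs) f ≡ ∏[ x ∈ xs ] ∏ (g x) f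
  ∏-concatMap g []       f = refl
  ∏-concatMap g (x ∷ xs) f =
    trans (∏-++ (g x) (concatMap g xs) f) (cong (∏ (g x) f *_) (∏-concatMap g xs f))

  ∑-swap : (xs : List A) (ys : List B) (f : A → B → ℤ) →
    ∑[ x ∈ xs ] ∑[ y ∈ ys ] f x y ≡ ∑[ y ∈ ys ] ∑[ x ∈ xs ] f x y
  ∑-swap []       ys f = sym (∑-zero ys)
  ∑-swap (x ∷ xs) ys f =
    trans (cong (λ z → ∑ ys (f x) + z) (∑-swap xs ys f)) (sym (∑-+ ys (f x) (λ y → ∑[ x ∈ xs ] f x y)))

fromBool : Bool → ℤ
fromBool true  = 1ℤ
fromBool false = 0ℤ

𝟙 : ∀ {p} {P : Set p} → Dec P → ℤ
𝟙 d = fromBool (does d)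

𝟙-¬ : ∀ {p} {P : Set p} (d : Dec P) → 𝟙 (¬? d) ≡ 1ℤ - 𝟙 d
𝟙-¬ (yes _) = refl
𝟙-¬ (no _)  = refl

𝟙-all : ∀ {a p} {A : Set a} {P : A → Set p} (P? : ∀ x → Dec (P x)) (xs : List A) →
  𝟙 (all? P? xs) ≡ ∏[ x ∈ xs ] 𝟙 (P? x)
𝟙-all P? []       = refl
𝟙-all P? (x ∷ xs) = trans (fromBool-∧ (does (P? x)) _) (cong (𝟙 (P? x) *_) (𝟙-all P? xs))
  where
  fromBool-∧ : ∀ b c → fromBool (b ∧ c) ≡ fromBool b * fromBool c
  fromBool-∧ true  c = sym (ℤP.*-identityˡ _)
  fromBool-∧ false c = sym (ℤP.*-zeroˡ (fromBool c))

count-filter : ∀ {a p} {A : Set a} {P : A → Set p} (P? : ∀ x → Dec (P x)) (xs : List A) →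
  + length (filter P? xs) ≡ ∑[ x ∈ xs ] 𝟙 (P? x)
count-filter P? []       = refl
count-filter P? (x ∷ xs) with does (P? x)
... | false = trans (count-filter P? xs) (sym (ℤP.+-identityˡ _))
... | true  = cong (λ z → 1ℤ + z) (count-filter P? xs)

δ : ℤ → ℤ → ℤ
δ a b = 𝟙 (a ℤ.≟ b)

δ-sym : ∀ a b → δ a b ≡ δ b a
δ-sym a b with a ℤ.≟ b | b ℤ.≟ a
... | yes _ | yes _  = refl
... | no _  | no _   = refl
... | yes e | no b≢a = ⊥-elim (b≢a (sym e))
... | no a≢b | yes e = ⊥-elim (a≢b (sym e))

δ-transfer : ∀ x a b → δ x a * δ x b ≡ δ a b * δ x b
δ-transfer x a b with x ℤ.≟ a | a ℤ.≟ b | x ℤ.≟ b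
... | yes _    | yes _    | yes _    = refl
... | yes _    | yes _    | no _     = refl
... | yes refl | no a≢b   | yes refl = ⊥-elim (a≢b refl)
... | yes _    | no _     | no _     = refl
... | no _     | yes _    | no _     = refl
... | no x≢a   | yes refl | yes refl = ⊥-elim (x≢a refl)
... | no _     | no _     | yes _    = refl
... | no _     | no _     | no _     = refl

∑-δ-absent : ∀ {b} (xs : List ℤ) → b ∉ xs → ∑[ x ∈ xs ] δ x b ≡ 0ℤ
∑-δ-absent []       b∉ = refl
∑-δ-absent {b} (x ∷ xs) b∉ with x ℤ.≟ b
... | yes x≡b = ⊥-elim (b∉ (here (sym x≡b)))
... | no _    = trans (ℤP.+-identityˡ _) (∑-δ-absent xs (b∉ ∘ there))

∑-δ-unique : ∀ {b} {xs : List ℤ} → Unique xs → b ∈ xs → ∑[ x ∈ xs ] δ x b ≡ 1ℤ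
∑-δ-unique {xs = x ∷ xs} (x∉ ∷ _) (here refl) with x ℤ.≟ x
... | yes _   = cong (λ z → 1ℤ + z) (∑-δ-absent xs (λ x∈ → All.lookup x∉ x∈ refl))
... | no x≢x  = ⊥-elim (x≢x refl)
∑-δ-unique {b} {x ∷ xs} (x∉ ∷ u) (there b∈) with x ℤ.≟ b
... | yes x≡b = ⊥-elim (All.lookup x∉ b∈ x≡b)
... | no _    = trans (ℤP.+-identityˡ _) (∑-δ-unique u b∈)

colours-length : ∀ k → + length (colours k) ≡ 1ℤ + + (2 ℕ.* k)
colours-length k =
  cong +_ (trans (LP.length-map _ (upTo (suc (2 ℕ.* k)))) (LP.length-upTo (suc (2 ℕ.* k))))

colours-unique : ∀ k → Unique (colours k)
colours-unique k = UniqueP.map⁺ shift-injective (UniqueP.upTo⁺ (suc (2 ℕ.* k)))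
  where
  unshift : ∀ x y → x ≡ x - y + y
  unshift = solve-∀
  shift-injective : ∀ {i j} → + i - + k ≡ + j - + k → i ≡ j
  shift-injective {i} {j} e =
    ℤP.+-injective (trans (unshift (+ i) (+ k)) (trans (cong (_+ + k) e) (sym (unshift (+ j) (+ k)))))

∑-δ-colours : ∀ k {b} → b ∈ colours k → (c : ℤ) → ∑[ x ∈ colours k ] (c * δ x b) ≡ c
∑-δ-colours k b∈ c = begin
  ∑[ x ∈ colours k ] (c * δ x _)  ≡⟨ ∑-*ˡ (colours k) c (λ x → δ x _) ⟩
  c * ∑[ x ∈ colours k ] δ x _    ≡⟨ cong (c *_) (∑-δ-unique (colours-unique k) b∈) ⟩
  c * 1ℤ                           ≡⟨ ℤP.*-identityʳ c ⟩
  c                                ∎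
  where open ≡-Reasoning

∑-colourings-suc : ∀ k N (g : Vec ℤ (suc N) → ℤ) →
  ∑ (colourings k (suc N)) g ≡ ∑[ a ∈ colours k ] ∑[ v ∈ colourings k N ] g (a ∷ v)
∑-colourings-suc k N g = trans (∑-concatMap (λ a → map (a ∷_) (colourings k N)) (colours k) g)
  (∑-ext (colours k) (λ a → ∑-map (a ∷_) (colourings k N) g))

∑-colourings-++ : ∀ k N M (g : Vec ℤ (N ℕ.+ M) → ℤ) →
  ∑ (colourings k (N ℕ.+ M)) g ≡ ∑[ w ∈ colourings k N ] ∑[ r ∈ colourings k M ] g (w ++ᵥ r)
∑-colourings-++ k zero    M g = sym (ℤP.+-identityʳ _)
∑-colourings-++ k (suc N) M g = trans (∑-colourings-suc k (N ℕ.+ M) g)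
  (trans (∑-ext (colours k) (λ a → ∑-colourings-++ k N M (g ∘ (a ∷_))))
         (sym (∑-colourings-suc k N (λ w → ∑[ r ∈ colourings k M ] g (w ++ᵥ r)))))

χ-book-sum : ∀ m n k → + χ (Book m n) k ≡
  ∑[ a ∈ colours k ] ∑[ b ∈ colours k ] ∑[ v ∈ colourings k (n ℕ.* (m ∸ 2)) ]
    𝟙 (proper? (Book m n) (a ∷ b ∷ v))
χ-book-sum m n k = trans (count-filter (proper? G) (colourings k (nV G)))
  (trans (∑-colourings-suc k _ (𝟙 ∘ proper? G))
         (∑-ext (colours k) (λ a → ∑-colourings-suc k _ (𝟙 ∘ proper? G ∘ (a ∷_)))))
  where G = Book m n

edgeInd : ∀ {N} → Vec ℤ N → Fin N × Fin N × Sgn → ℤ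
edgeInd c (x , y , s) = 𝟙 (¬? (lookup c y ℤ.≟ act s (lookup c x)))

proper-as-product : (G : SignedGraph) (c : Vec ℤ (nV G)) →
  𝟙 (proper? G c) ≡ ∏[ e ∈ edges G ] edgeInd c e
proper-as-product G c = 𝟙-all _ (edges G)

distinct : ℤ → ℤ → ℤ
distinct a b = 𝟙 (¬? (b ℤ.≟ a))

distinct≡ : ∀ a b → distinct a b ≡ 1ℤ - δ b a
distinct≡ a b = 𝟙-¬ (b ℤ.≟ a)

distinct-refl : ∀ a → distinct a a ≡ 0ℤ
distinct-refl a with a ℤ.≟ a
... | yes _   = refl
... | no a≢a  = ⊥-elim (a≢a refl)

pathInd : ∀ {q} → ℤ → Vec ℤ q → ℤ → ℤ
pathInd a []      b = distinct a b
pathInd a (x ∷ w) b = distinct a x * pathInd x w b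

-- the path indicator in the edge order used by pageEdges:
-- first edge, last edge, then the inner edges
pathInd-tabulate : ∀ p a (f : Fin (suc p) → ℤ) b →
  pathInd a (tabulate f) b ≡
    distinct a (f zero) * (distinct (f (fromℕ p)) b *
      ∏[ j ∈ allFin p ] distinct (f (inject₁ j)) (f (suc j)))
pathInd-tabulate zero     a f b = cong (distinct a (f zero) *_) (sym (ℤP.*-identityʳ _))
pathInd-tabulate (suc p) a f b = begin
    distinct a (f zero) * pathInd (f zero) (tabulate (f ∘ suc)) b
  ≡⟨ cong (distinct a (f zero) *_) (pathInd-tabulate p (f zero) (f ∘ suc) b) ⟩
    distinct a (f zero) * (first * (last * ∏[ j ∈ allFin p ] inner (suc j)))
  ≡⟨ cong (distinct a (f zero) *_) (swap12 first last _) ⟩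
    distinct a (f zero) * (last * (first * ∏[ j ∈ allFin p ] inner (suc j)))
  ≡⟨ cong (λ z → distinct a (f zero) * (last * z)) (sym inner-shift) ⟩
    distinct a (f zero) * (last * ∏[ j ∈ allFin (suc p) ] inner j)
  ∎
  where
  open ≡-Reasoning
  inner : Fin (suc p) → ℤ
  inner j = distinct (f (inject₁ j)) (f (suc j))
  first last : ℤ
  first = inner zero
  last  = distinct (f (fromℕ (suc p))) b
  inner-shift : ∏ (allFin (suc p)) inner ≡ first * ∏[ j ∈ allFin p ] inner (suc j)
  inner-shift = cong (first *_)
    (trans (cong (λ js → ∏ js inner) (sym (LP.map-tabulate id suc))) (∏-map suc (allFin p) inner))
  swap12 : ∀ x y z → x * (y * z) ≡ y * (x * z)
  swap12 = solve-∀

module PathCount (k : ℕ) where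

  C : List ℤ
  C = colours k

  M : ℤ
  M = + (2 ℕ.* k)

  T : ℕ → ℤ
  T q = bookFactor (2 ℕ.+ q) k

  T-suc : ∀ q → T (suc q) ≡ M * T q + -1ℤ ^ suc q
  T-suc q = begin
      T (suc q)
    ≡⟨ foldr-sum (term (suc q)) (upTo (suc (suc q))) ⟩
      ∑ (upTo (suc (suc q))) (term (suc q))
    ≡⟨ cong (λ is → ∑ is (term (suc q))) (sym (LP.upTo-∷ʳ (suc q))) ⟩
      ∑ (upTo (suc q) ∷ʳ suc q) (term (suc q))
    ≡⟨ ∑-++ (upTo (suc q)) (suc q ∷ []) (term (suc q)) ⟩
      ∑ (upTo (suc q)) (term (suc q)) + (term (suc q) (suc q) + 0ℤ)
    ≡⟨ cong₂ _+_ (∑-cong (upTo (suc q)) lower-term) top-term ⟩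
      ∑[ i ∈ upTo (suc q) ] (M * term q i) + -1ℤ ^ suc q
    ≡⟨ cong (_+ -1ℤ ^ suc q) (∑-*ˡ (upTo (suc q)) M (term q)) ⟩
      M * ∑ (upTo (suc q)) (term q) + -1ℤ ^ suc q
    ≡⟨ cong (λ z → M * z + -1ℤ ^ suc q) (sym (foldr-sum (term q) (upTo (suc q)))) ⟩
      M * T q + -1ℤ ^ suc q
    ∎
    where
    open ≡-Reasoning
    term : ℕ → ℕ → ℤ
    term q i = -1ℤ ^ i * M ^ (q ∸ i)
    swap12 : ∀ x y z → x * (y * z) ≡ y * (x * z)
    swap12 = solve-∀
    lower-term : ∀ {i} → i ∈ upTo (suc q) → term (suc q) i ≡ M * term q i
    lower-term {i} i∈ with ∈-upTo⁻ i∈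
    ... | s≤s i≤q = trans (cong (λ e → -1ℤ ^ i * M ^ e) (ℕP.+-∸-assoc 1 i≤q))
                          (swap12 (-1ℤ ^ i) M (M ^ (q ∸ i)))
    top-term : term (suc q) (suc q) + 0ℤ ≡ -1ℤ ^ suc q
    top-term = trans (ℤP.+-identityʳ _)
      (trans (cong (λ e → -1ℤ ^ suc q * M ^ e) (ℕP.n∸n≡0 q)) (ℤP.*-identityʳ _))

  paths : ℕ → ℤ → ℤ → ℤ
  paths q a b = ∑[ w ∈ colourings k q ] pathInd a w b

  paths-suc : ∀ q a b → paths (suc q) a b ≡ ∑[ x ∈ C ] (distinct a x * paths q x b)
  paths-suc q a b = trans (∑-colourings-suc k q (λ w → pathInd a w b))
    (∑-ext C (λ x → ∑-*ˡ (colourings k q) (distinct a x) (λ v → pathInd x v b)))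

  -- one step of the path recursion, summed over the colour x of the new vertex
  colour-step : ∀ {a b} → a ∈ C → b ∈ C → ∀ t s →
    ∑[ x ∈ C ] ((1ℤ - δ x a) * (t - δ x b * s)) ≡ M * t + (s * δ a b - s)
  colour-step {a} {b} a∈ b∈ t s = begin
      ∑[ x ∈ C ] ((1ℤ - δ x a) * (t - δ x b * s))
    ≡⟨ ∑-ext C expand ⟩
      ∑[ x ∈ C ] (t + (- t * δ x a + d * δ x b))
    ≡⟨ ∑-+ C (λ _ → t) (λ x → - t * δ x a + d * δ x b) ⟩
      ∑[ x ∈ C ] t + ∑[ x ∈ C ] (- t * δ x a + d * δ x b)
    ≡⟨ cong₂ _+_ (∑-const C t) (∑-+ C (λ x → - t * δ x a) (λ x → d * δ x b)) ⟩
      + length C * t + (∑[ x ∈ C ] (- t * δ x a) + ∑[ x ∈ C ] (d * δ x b))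
    ≡⟨ cong₂ _+_ (cong (_* t) (colours-length k))
                 (cong₂ _+_ (∑-δ-colours k a∈ (- t)) (∑-δ-colours k b∈ d)) ⟩
      (1ℤ + M) * t + (- t + d)
    ≡⟨ collect M t d ⟩
      M * t + d
    ∎
    where
    open ≡-Reasoning
    d : ℤ
    d = s * δ a b - s
    collect : ∀ M t d → (1ℤ + M) * t + (- t + d) ≡ M * t + d
    collect = solve-∀
    multiply-out : ∀ A B t s → (1ℤ - A) * (t - B * s) ≡ t + (- t * A + (s * (A * B) - s * B))
    multiply-out = solve-∀
    regroup : ∀ A B D t s → t + (- t * A + (s * (D * B) - s * B)) ≡ t + (- t * A + (s * D - s) * B)
    regroup = solve-∀
    expand : ∀ x → (1ℤ - δ x a) * (t - δ x b * s) ≡ t + (- t * δ x a + d * δ x b)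
    expand x = begin
        (1ℤ - δ x a) * (t - δ x b * s)
      ≡⟨ multiply-out (δ x a) (δ x b) t s ⟩
        t + (- t * δ x a + (s * (δ x a * δ x b) - s * δ x b))
      ≡⟨ cong (λ z → t + (- t * δ x a + (s * z - s * δ x b))) (δ-transfer x a b) ⟩
        t + (- t * δ x a + (s * (δ a b * δ x b) - s * δ x b))
      ≡⟨ regroup (δ x a) (δ x b) (δ a b) t s ⟩
        t + (- t * δ x a + d * δ x b)
      ∎

  paths-formula : ∀ q {a b} → a ∈ C → b ∈ C → paths q a b ≡ T q - δ a b * -1ℤ ^ q
  paths-formula zero {a} {b} _ _ = begin
      distinct a b + 0ℤ  ≡⟨ ℤP.+-identityʳ _ ⟩
      distinct a b       ≡⟨ distinct≡ a b ⟩
      1ℤ - δ b a         ≡⟨ cong (λ z → 1ℤ - z) (trans (δ-sym b a) (sym (ℤP.*-identityʳ _))) ⟩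
      1ℤ - δ a b * 1ℤ    ∎
    where open ≡-Reasoning
  paths-formula (suc q) {a} {b} a∈ b∈ = begin
      paths (suc q) a b
    ≡⟨ paths-suc q a b ⟩
      ∑[ x ∈ C ] (distinct a x * paths q x b)
    ≡⟨ ∑-cong C (λ {x} x∈ → cong₂ _*_ (distinct≡ a x) (paths-formula q x∈ b∈)) ⟩
      ∑[ x ∈ C ] ((1ℤ - δ x a) * (T q - δ x b * s))
    ≡⟨ colour-step a∈ b∈ (T q) s ⟩
      M * T q + (s * δ a b - s)
    ≡⟨ sign-flip M (T q) s (δ a b) ⟩
      (M * T q + -1ℤ * s) - δ a b * (-1ℤ * s)
    ≡⟨ cong (λ z → z - δ a b * -1ℤ ^ suc q) (sym (T-suc q)) ⟩
      T (suc q) - δ a b * -1ℤ ^ suc q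
    ∎
    where
    open ≡-Reasoning
    s : ℤ
    s = -1ℤ ^ q
    sign-flip : ∀ M t s e → M * t + (s * e - s) ≡ (M * t + -1ℤ * s) - e * (-1ℤ * s)
    sign-flip = solve-∀

page-ind : ∀ n p l (c : Vec ℤ (2 ℕ.+ n ℕ.* suc p)) →
  ∏ (pageEdges n (suc p) l) (edgeInd c) ≡
    pathInd (lookup c (bu n (suc p))) (tabulate (lookup c ∘ bw n (suc p) l)) (lookup c (bv n (suc p)))
page-ind n p l c = trans
  (cong (λ z → distinct cu (f zero) * (distinct (f (fromℕ p)) cv * z)) (∏-map inner (allFin p) (edgeInd c)))
  (sym (pathInd-tabulate p cu f cv))
  where
  cu cv : ℤ
  cu = lookup c (bu n (suc p))
  cv = lookup c (bv n (suc p))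
  f : Fin (suc p) → ℤ
  f = lookup c ∘ bw n (suc p) l
  inner : Fin p → BV n (suc p) × BV n (suc p) × Sgn
  inner j = (bw n (suc p) l (inject₁ j) , bw n (suc p) l (suc j) , pos)

-- Colour B with n'+1 pages by (a, b, w ++ r) and B with
-- n' pages by (a, b, r): the first page contributes the path indicator of a, w, b,
-- and page l+1 of the larger book is coloured exactly like page l of the smaller.
pages-split : ∀ p n' a b (w : Vec ℤ (suc p)) (r : Vec ℤ (n' ℕ.* suc p)) →
  ∏ (concatMap (pageEdges (suc n') (suc p)) (allFin (suc n'))) (edgeInd (a ∷ b ∷ (w ++ᵥ r)))
    ≡ pathInd a w b * ∏ (concatMap (pageEdges n' (suc p)) (allFin n')) (edgeInd (a ∷ b ∷ r))
pages-split p n' a b w r = begin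
    ∏ (concatMap (pageEdges (suc n') q) (allFin (suc n'))) (edgeInd c)
  ≡⟨ ∏-concatMap (pageEdges (suc n') q) (allFin (suc n')) (edgeInd c) ⟩
    page c zero * ∏ (List.tabulate suc) (page c)
  ≡⟨ cong (page c zero *_) (trans (cong (λ ls → ∏ ls (page c)) (sym (LP.map-tabulate id suc)))
                                   (∏-map suc (allFin n') (page c))) ⟩
    page c zero * ∏[ l ∈ allFin n' ] page c (suc l)
  ≡⟨ cong₂ _*_ first-page (∏-ext (allFin n') later-page) ⟩
    pathInd a w b * ∏[ l ∈ allFin n' ] page′ c′ l
  ≡⟨ cong (pathInd a w b *_) (sym (∏-concatMap (pageEdges n' q) (allFin n') (edgeInd c′))) ⟩
    pathInd a w b * ∏ (concatMap (pageEdges n' q) (allFin n')) (edgeInd c′)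
  ∎
  where
  open ≡-Reasoning
  q : ℕ
  q = suc p
  c : Vec ℤ (2 ℕ.+ suc n' ℕ.* q)
  c = a ∷ b ∷ (w ++ᵥ r)
  c′ : Vec ℤ (2 ℕ.+ n' ℕ.* q)
  c′ = a ∷ b ∷ r
  page : Vec ℤ (2 ℕ.+ suc n' ℕ.* q) → Fin (suc n') → ℤ
  page c l = ∏ (pageEdges (suc n') q l) (edgeInd c)
  page′ : Vec ℤ (2 ℕ.+ n' ℕ.* q) → Fin n' → ℤ
  page′ c l = ∏ (pageEdges n' q l) (edgeInd c)
  first-page : page c zero ≡ pathInd a w b
  first-page = trans (page-ind (suc n') p zero c) (cong (λ v → pathInd a v b)
    (trans (VecP.tabulate-cong (VecP.lookup-++ˡ w r)) (VecP.tabulate∘lookup w)))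
  later-page : ∀ l → page c (suc l) ≡ page′ c′ l
  later-page l = trans (page-ind (suc n') p (suc l) c)
    (trans (cong (λ v → pathInd a v b) (VecP.tabulate-cong (λ j → VecP.lookup-++ʳ w r (combine l j))))
           (sym (page-ind n' p l c′)))

book-split : ∀ p n' a b (w : Vec ℤ (suc p)) (r : Vec ℤ (n' ℕ.* suc p)) →
  𝟙 (proper? (Book (3 ℕ.+ p) (suc n')) (a ∷ b ∷ (w ++ᵥ r)))
    ≡ 𝟙 (proper? (Book (3 ℕ.+ p) n') (a ∷ b ∷ r)) * pathInd a w b
book-split p n' a b w r = begin
    𝟙 (proper? (Book m (suc n')) (a ∷ b ∷ (w ++ᵥ r)))
  ≡⟨ proper-as-product (Book m (suc n')) (a ∷ b ∷ (w ++ᵥ r)) ⟩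
    positive * (negative * ∏ (concatMap (pageEdges (suc n') q) (allFin (suc n'))) (edgeInd (a ∷ b ∷ (w ++ᵥ r))))
  ≡⟨ cong (λ z → positive * (negative * z)) (pages-split p n' a b w r) ⟩
    positive * (negative * (pathInd a w b * pages′))
  ≡⟨ rearrange positive negative (pathInd a w b) pages′ ⟩
    positive * (negative * pages′) * pathInd a w b
  ≡⟨ cong (_* pathInd a w b) (sym (proper-as-product (Book m n') (a ∷ b ∷ r))) ⟩
    𝟙 (proper? (Book m n') (a ∷ b ∷ r)) * pathInd a w b
  ∎
  where
  open ≡-Reasoning
  q m : ℕ
  q = suc p
  m = 2 ℕ.+ q
  positive negative pages′ : ℤ
  positive = distinct a b
  negative = 𝟙 (¬? (b ℤ.≟ - a))
  pages′ = ∏ (concatMap (pageEdges n' q) (allFin n')) (edgeInd (a ∷ b ∷ r))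
  rearrange : ∀ x y z t → x * (y * (z * t)) ≡ x * (y * t) * z
  rearrange = solve-∀

spine-distinct : ∀ m n a b r → 𝟙 (proper? (Book m n) (a ∷ b ∷ r)) * δ a b ≡ 0ℤ
spine-distinct m n a b r with a ℤ.≟ b
... | no _     = ℤP.*-zeroʳ (𝟙 (proper? (Book m n) (a ∷ b ∷ r)))
... | yes refl = trans (ℤP.*-identityʳ _)
  (trans (proper-as-product (Book m n) (a ∷ a ∷ r))
         (trans (cong (_* other-edges) (distinct-refl a)) (ℤP.*-zeroˡ other-edges)))
  where
  other-edges : ℤ
  other-edges = ∏ (List.drop 1 (edges (Book m n))) (edgeInd (a ∷ a ∷ r))

module BookRecursion (p n' k : ℕ) where
  open PathCount k

  q m : ℕ
  q = suc p
  m = 2 ℕ.+ q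

  J : ℤ → ℤ → Vec ℤ (n' ℕ.* q) → ℤ
  J a b r = 𝟙 (proper? (Book m n') (a ∷ b ∷ r))

  -- since a proper colouring has a ≠ b, the first page admits exactly T q colourings
  J-paths : ∀ {a b} → a ∈ C → b ∈ C → ∀ r → J a b r * paths q a b ≡ T q * J a b r
  J-paths {a} {b} a∈ b∈ r = begin
      J a b r * paths q a b
    ≡⟨ cong (J a b r *_) (paths-formula q a∈ b∈) ⟩
      J a b r * (T q - δ a b * s)
    ≡⟨ distribute (J a b r) (T q) (δ a b) s ⟩
      T q * J a b r - J a b r * δ a b * s
    ≡⟨ cong (λ z → T q * J a b r - z * s) (spine-distinct m n' a b r) ⟩
      T q * J a b r - 0ℤ * s
    ≡⟨ drop-zero (T q * J a b r) s ⟩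
      T q * J a b r
    ∎
    where
    open ≡-Reasoning
    s : ℤ
    s = -1ℤ ^ q
    distribute : ∀ j t d s → j * (t - d * s) ≡ t * j - j * d * s
    distribute = solve-∀
    drop-zero : ∀ x s → x - 0ℤ * s ≡ x
    drop-zero = solve-∀

  first-page-sum : ∀ {a b} → a ∈ C → b ∈ C →
    ∑[ v ∈ colourings k (q ℕ.+ n' ℕ.* q) ] 𝟙 (proper? (Book m (suc n')) (a ∷ b ∷ v))
      ≡ T q * ∑[ r ∈ colourings k (n' ℕ.* q) ] J a b r
  first-page-sum {a} {b} a∈ b∈ = begin
      ∑[ v ∈ colourings k (q ℕ.+ n' ℕ.* q) ] 𝟙 (proper? (Book m (suc n')) (a ∷ b ∷ v))
    ≡⟨ ∑-colourings-++ k q (n' ℕ.* q) (λ v → 𝟙 (proper? (Book m (suc n')) (a ∷ b ∷ v))) ⟩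
      ∑[ w ∈ Wq ] ∑[ r ∈ Rq ] 𝟙 (proper? (Book m (suc n')) (a ∷ b ∷ (w ++ᵥ r)))
    ≡⟨ ∑-ext Wq (λ w → ∑-ext Rq (book-split p n' a b w)) ⟩
      ∑[ w ∈ Wq ] ∑[ r ∈ Rq ] (J a b r * pathInd a w b)
    ≡⟨ ∑-swap Wq Rq (λ w r → J a b r * pathInd a w b) ⟩
      ∑[ r ∈ Rq ] ∑[ w ∈ Wq ] (J a b r * pathInd a w b)
    ≡⟨ ∑-ext Rq (λ r → ∑-*ˡ Wq (J a b r) (λ w → pathInd a w b)) ⟩
      ∑[ r ∈ Rq ] (J a b r * paths q a b)
    ≡⟨ ∑-ext Rq (J-paths a∈ b∈) ⟩
      ∑[ r ∈ Rq ] (T q * J a b r)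
    ≡⟨ ∑-*ˡ Rq (T q) (J a b) ⟩
      T q * ∑[ r ∈ Rq ] J a b r
    ∎
    where
    open ≡-Reasoning
    Wq : List (Vec ℤ q)
    Wq = colourings k q
    Rq : List (Vec ℤ (n' ℕ.* q))
    Rq = colourings k (n' ℕ.* q)

  χ-recursion : + χ (Book m (suc n')) k ≡ T q * + χ (Book m n') k
  χ-recursion = begin
      + χ (Book m (suc n')) k
    ≡⟨ χ-book-sum m (suc n') k ⟩
      ∑[ a ∈ C ] ∑[ b ∈ C ] ∑[ v ∈ colourings k (q ℕ.+ n' ℕ.* q) ] 𝟙 (proper? (Book m (suc n')) (a ∷ b ∷ v))
    ≡⟨ ∑-cong C (λ a∈ → ∑-cong C (λ b∈ → first-page-sum a∈ b∈)) ⟩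
      ∑[ a ∈ C ] ∑[ b ∈ C ] (T q * smaller a b)
    ≡⟨ ∑-ext C (λ a → ∑-*ˡ C (T q) (smaller a)) ⟩
      ∑[ a ∈ C ] (T q * ∑[ b ∈ C ] smaller a b)
    ≡⟨ ∑-*ˡ C (T q) (λ a → ∑[ b ∈ C ] smaller a b) ⟩
      T q * ∑[ a ∈ C ] ∑[ b ∈ C ] smaller a b
    ≡⟨ cong (T q *_) (sym (χ-book-sum m n' k)) ⟩
      T q * + χ (Book m n') k
    ∎
    where
    open ≡-Reasoning
    smaller : ℤ → ℤ → ℤ
    smaller a b = ∑[ r ∈ colourings k (n' ℕ.* q) ] J a b r

proposition6p5 : (m n : ℕ) → 3 ≤ m → 2 ≤ n → (k : ℕ) → 1 ≤ k →
    + χ (Book m n) k ≡ bookFactor m k * + χ (Book m (pred n)) k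
proposition6p5 (suc (suc (suc p))) (suc (suc n″)) (s≤s (s≤s (s≤s _))) (s≤s (s≤s _)) k _ =
  BookRecursion.χ-recursion p (suc n″) k
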